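{- For all integers $N\ge 1$ and $0\le k\le \lfloor (N-1)/2\rfloor$, \[ b_{k}^{(N)} = \frac{(-1)^{N-1-k}}{2^{N-1}}\, p_{N-1-2k}^{(N-1)}. \] Moreover, under this correspondence, the recurrence $b_{k}^{(N+1)} = - \frac{1}{N} b_{k}^{(N)} + \frac{1}{4} b_{k-1}^{(N-1)}$ is equivalent to the three-term recurrence \[ (m+1) P_{m+1}^{(1)} \!\left( x; \tfrac{\pi}{2} \right) - 2x P_{m}^{(1)} \!\left( x; \tfrac{\pi}{2} \right) + (m+1) P_{m-1}^{(1)}\!\left(x; \tfrac{\pi}{2} \right) = 0 \] satisfied by the Meixner–Pollaczek polynomials.
   Context: The Dilcher coefficients $b_k^{(N)}$ are defined by $b_0^{(1)}=1$, $b_k^{(N)}=0$ for $k<0$ and for $k>\lfloor (N-1)/2\rfloor$, and the recurrence $b_{k}^{(N+1)} = - \frac{1}{N} b_{k}^{(N)} + \frac{1}{4} b_{k-1}^{(N-1)}$. (They satisfy $S_N(n)=\frac{(2n)!}{(2n-N)!}\sum_{k=0}^{\lfloor (N-1)/2\rfloor} b_k^{(N)} \frac{B_{2n-2k}}{2n-2k}$, where $S_N(n)=\sum_{j_1+\cdots+j_N=n}\frac{(2n)!}{(2j_1)!\cdots(2j_N)!}B_{2j_1}\cdots B_{2j_N}$ and $B_m$ are the classical Bernoulli numbers.) The Meixner–Pollaczek polynomials are \[ P_{m}^{(\lambda)}(x;\phi) = \frac{(2 \lambda)_{m}}{m!} e^{i m \phi}\, {}_2F_1\!\left( \begin{matrix}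 -m, \; \lambda + i x \\ 2 \lambda \end{matrix} \,\Big|\, 1 - e^{ -2 i \phi} \right), \] with $(x)_\ell$ the Pochhammer symbol, and $p_k^{(m)}$ denotes the coefficients in $P_{m}^{(1)}(x;\pi/2)=\sum_{k=0}^{m} p_k^{(m)} x^k$. -}

module Defs where

open import Data.Nat as ℕ using (ℕ; zero; suc; _!)
open import Data.Nat.Properties using (_!*_!≢0)
open import Data.Integer as ℤ using (ℤ; +_; -[1+_])
open import Data.Rational as ℚ using (ℚ; 0ℚ; 1ℚ; _+_; _*_; -_; _-_; _/_)
open import Data.Product using (_×_; _,_; proj₁; proj₂)
open import Data.List using (List; []; _∷_)

_^ℚ_ : ℚ → ℕ → ℚ
q ^ℚ zero = 1ℚ
q ^ℚ suc n = q * (q ^ℚ n)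

ℕ→ℚ : ℕ → ℚ
ℕ→ℚ n = + n / 1

signℚ : ℕ → ℚ
signℚ n = (- 1ℚ) ^ℚ n

inv2^ : ℕ → ℚ
inv2^ n = (+ 1 / 2) ^ℚ n

-- Dilcher coefficients  dilcher N k = b_k^{(N)}
-- b_k^{(1)} = δ_{k0};  b^{(0)} ≡ 0 (only ever used at k-1 ≥ 0, where it
-- lies outside the range 0 ≤ k-1 ≤ ⌊-1/2⌋ and hence vanishes);
-- b_k^{(N+1)} = -(1/N) b_k^{(N)} + (1/4) b_{k-1}^{(N-1)}, with b_{-1} = 0.
-- (The recurrence automatically gives b_k^{(N)} = 0 for k > ⌊(N-1)/2⌋.)

dilcher : ℕ → ℕ → ℚ
dilcher zero k = 0ℚ
dilcher (suc zero) zero = 1ℚ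
dilcher (suc zero) (suc k) = 0ℚ
dilcher (suc (suc n)) zero = - ((+ 1 / suc n) * dilcher (suc n) zero)
dilcher (suc (suc n)) (suc k) =
  - ((+ 1 / suc n) * dilcher (suc n) (suc k)) + (+ 1 / 4) * dilcher n k

dilcherPred : ℕ → ℕ → ℚ
dilcherPred N zero = 0ℚ
dilcherPred N (suc k) = dilcher N k

-- Gaussian rationals ℚ(i) = ℚ × ℚ  (re , im)

ℚi : Set
ℚi = ℚ × ℚ

0i : ℚi
0i = 0ℚ , 0ℚ

_+i_ : ℚi → ℚi → ℚi
(a , b) +i (c , d) = (a + c) , (b + d)

_*i_ : ℚi → ℚi → ℚi
(a , b) *i (c , d) = (a * c - b * d) , (a * d + b * c)

-iᶜ_ : ℚi → ℚi
-iᶜ (a , b) = (- a) , (- b)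

re : ℚ → ℚi
re q = q , 0ℚ

imagUnit : ℚi
imagUnit = 0ℚ , 1ℚ

_^i_ : ℚi → ℕ → ℚi
z ^i zero = re 1ℚ
z ^i suc n = z *i (z ^i n)

-- Polynomials in x over ℚ(i), as coefficient lists (constant term first)

Poly : Set
Poly = List ℚi

coeff : Poly → ℕ → ℚi
coeff [] k = 0i
coeff (c ∷ p) zero = c
coeff (c ∷ p) (suc k) = coeff p k

_+P_ : Poly → Poly → Poly
[] +P q = q
(c ∷ p) +P [] = c ∷ p
(c ∷ p) +P (d ∷ q) = (c +i d) ∷ (p +P q)

_·P_ : ℚi → Poly → Poly
a ·P [] = []
a ·P (c ∷ p) = (a *i c) ∷ (a ·P p)

xP : Poly → Poly
xP p = 0i ∷ p

mulLin : ℚi → ℚi → Poly → Poly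
mulLin a b p = (a ·P p) +P (b ·P xP p)

sumP : ℕ → (ℕ → Poly) → Poly
sumP zero f = []
sumP (suc n) f = sumP n f +P f n

-- P_m^{(λ)}(x;φ) = (2λ)_m/m! e^{imφ} 2F1(-m, λ+ix; 2λ; 1-e^{-2iφ}).
-- At λ = 1, φ = π/2:  (2)_m/m! = m+1,  e^{imπ/2} = i^m,
-- 1 - e^{-iπ} = 2, so
-- P_m^{(1)}(x;π/2) = (m+1) i^m Σ_{l=0}^{m} (-m)_l (1+ix)_l / ((2)_l l!) 2^l.

pochℚ : ℚ → ℕ → ℚ
pochℚ a zero = 1ℚ
pochℚ a (suc l) = pochℚ a l * (a + ℕ→ℚ l)

factℚ : ℕ → ℚ
factℚ zero = 1ℚ
factℚ (suc n) = factℚ n * ℕ→ℚ (suc n)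

pochPoly : ℕ → Poly
pochPoly zero = re 1ℚ ∷ []
pochPoly (suc l) = mulLin (re (ℕ→ℚ (suc l))) imagUnit (pochPoly l)

-- l-th coefficient of the 2F1 series:  (-m)_l 2^l / ((2)_l l!),
-- where (2)_l = (l+1)!
hypCoeff : ℕ → ℕ → ℚ
hypCoeff m l =
  pochℚ (- ℕ→ℚ m) l * ((+ 2 / 1) ^ℚ l) * (+ 1 / (suc l ! ℕ.* l !))
  where instance _ = (suc l) !* l !≢0

meixnerPollaczek : ℕ → Poly
meixnerPollaczek m =
  (re (ℕ→ℚ (suc m)) *i (imagUnit ^i m)) ·P
    sumP (suc m) (λ l → re (hypCoeff m l) ·P pochPoly l)

mpCoeff : ℕ → ℕ → ℚi
mpCoeff m k = coeff (meixnerPollaczek m) k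

-- left-hand side of the three-term recurrence at index m+1 (so that
-- the recurrence is stated for m+1 ≥ 1, and P_{(m+1)-1} = P_m):
-- (m+2) P_{m+2} - 2x P_{m+1} + (m+2) P_m
threeTermLHS : ℕ → Poly
threeTermLHS m =
  (re (ℕ→ℚ (suc (suc m))) ·P meixnerPollaczek (suc (suc m)))
  +P ((re (- (+ 2 / 1)) ·P xP (meixnerPollaczek (suc m)))
  +P (re (ℕ→ℚ (suc (suc m))) ·P meixnerPollaczek m))

{-# OPTIONS --safe #-}
module Submission where

-- At λ = 1, φ = π/2 the ₂F₁ gives P_m = (m + 1) iᵐ Σ_l h_m(l) (1 + i x)_l with h_m(l) = (-m)_l 2^l / ((2)_l l!).
-- Since i x (1 + i x)_l = (1 + i x)_{l+1} - (l + 1) (1 + i x)_l, the three-term recurrence reduces, term by term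
-- in the basis (1 + i x)_l, to the contiguous relation
--   (m + 3) h_{m+2}(l) = (m + 1) h_m(l) + 2 ((l + 1) h_{m+1}(l) - h_{m+1}(l - 1)),
-- an identity of Pochhammer symbols. Read coefficientwise, the three-term recurrence computes p^{(m+2)}_d from
-- p^{(m+1)}_{d-1} and p^{(m)}_d with exactly the weights of the Dilcher recurrence for the rescaled numbers
-- (-1)^{N-1-k} 2^{N-1} b_k^{(N)}; with equal initial values, and p^{(m)}_d = 0 for d > m matching b_{-1} = 0,
-- induction on N gives the correspondence.

open import Defs
open import Data.Nat as ℕ using (ℕ; zero; suc; _!; _≤_; _<_; _∸_; ⌊_/2⌋; s≤s)
import Data.Nat.Properties as ℕ
open import Data.Nat.Properties using (_!*_!≢0)
open import Data.Nat.Coprimality as Coprime using (1-coprimeTo)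
import Data.Nat.Tactic.RingSolver as ℕ-Solver
open import Data.Integer as ℤ using (+_)
import Data.Integer.Properties as ℤ
open import Data.Rational as ℚ using (ℚ; 0ℚ; 1ℚ; mkℚ; _+_; _*_; -_; _-_; _/_)
import Data.Rational.Properties as ℚ
open import Data.Product using (_×_; _,_)
open import Data.Product.Properties using (≡-dec)
open import Data.List using ([]; _∷_)
open import Function.Bundles using (_⇔_; mk⇔)
open import Relation.Nullary.Decidable using (dec⇒maybe)
open import Relation.Binary.PropositionalEquality
open import Algebra.Bundles using (CommutativeRing)
open import Algebra.Structures {A = ℚi} _≡_ using (IsCommutativeRing)
open import Algebra.Consequences.Propositional {A = ℚi}
  using (comm∧idˡ⇒id; comm∧distrˡ⇒distrʳ)
import Tactic.RingSolver.Core.AlmostCommutativeRing as ACR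
open import Tactic.RingSolver using (solve-∀)
open ≡-Reasoning

ℚ-ring : ACR.AlmostCommutativeRing _ _
ℚ-ring = ACR.fromCommutativeRing ℚ.+-*-commutativeRing (λ x → dec⇒maybe (0ℚ ℚ.≟ x))

+i-assoc : ∀ x y z → (x +i y) +i z ≡ x +i (y +i z)
+i-assoc (a , b) (c , d) (e , f) = cong₂ _,_ (ℚ.+-assoc a c e) (ℚ.+-assoc b d f)

+i-comm : ∀ x y → x +i y ≡ y +i x
+i-comm (a , b) (c , d) = cong₂ _,_ (ℚ.+-comm a c) (ℚ.+-comm b d)

+i-identityˡ : ∀ x → 0i +i x ≡ x
+i-identityˡ (a , b) = cong₂ _,_ (ℚ.+-identityˡ a) (ℚ.+-identityˡ b)

+i-identityʳ : ∀ x → x +i 0i ≡ x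
+i-identityʳ (a , b) = cong₂ _,_ (ℚ.+-identityʳ a) (ℚ.+-identityʳ b)

+i-inverseˡ : ∀ x → (-iᶜ x) +i x ≡ 0i
+i-inverseˡ (a , b) = cong₂ _,_ (ℚ.+-inverseˡ a) (ℚ.+-inverseˡ b)

+i-inverseʳ : ∀ x → x +i (-iᶜ x) ≡ 0i
+i-inverseʳ (a , b) = cong₂ _,_ (ℚ.+-inverseʳ a) (ℚ.+-inverseʳ b)

*i-comm : ∀ x y → x *i y ≡ y *i x
*i-comm (a , b) (c , d) = cong₂ _,_ (real a b c d) (imaginary a b c d)
  where
  real : ∀ a b c d → a * c - b * d ≡ c * a - d * b
  real = solve-∀ ℚ-ring
  imaginary : ∀ a b c d → a * d + b * c ≡ c * b + d * a
  imaginary = solve-∀ ℚ-ring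

*i-assoc : ∀ x y z → (x *i y) *i z ≡ x *i (y *i z)
*i-assoc (a , b) (c , d) (e , f) = cong₂ _,_ (real a b c d e f) (imaginary a b c d e f)
  where
  real : ∀ a b c d e f →
    (a * c - b * d) * e - (a * d + b * c) * f ≡ a * (c * e - d * f) - b * (c * f + d * e)
  real = solve-∀ ℚ-ring
  imaginary : ∀ a b c d e f →
    (a * c - b * d) * f + (a * d + b * c) * e ≡ a * (c * f + d * e) + b * (c * e - d * f)
  imaginary = solve-∀ ℚ-ring

*i-identityˡ : ∀ x → re 1ℚ *i x ≡ x
*i-identityˡ (a , b) = cong₂ _,_ (real a b) (imaginary a b)
  where
  real : ∀ a b → 1ℚ * a - 0ℚ * b ≡ a
  real = solve-∀ ℚ-ring
  imaginary : ∀ a b → 1ℚ * b + 0ℚ * a ≡ b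
  imaginary = solve-∀ ℚ-ring

*i-distribˡ-+i : ∀ x y z → x *i (y +i z) ≡ (x *i y) +i (x *i z)
*i-distribˡ-+i (a , b) (c , d) (e , f) = cong₂ _,_ (real a b c d e f) (imaginary a b c d e f)
  where
  real : ∀ a b c d e f → a * (c + e) - b * (d + f) ≡ (a * c - b * d) + (a * e - b * f)
  real = solve-∀ ℚ-ring
  imaginary : ∀ a b c d e f → a * (d + f) + b * (c + e) ≡ (a * d + b * c) + (a * f + b * e)
  imaginary = solve-∀ ℚ-ring

ℚi-isCommutativeRing : IsCommutativeRing _+i_ _*i_ -iᶜ_ 0i (re 1ℚ)
ℚi-isCommutativeRing = record
  { isRing = record
    { +-isAbelianGroup = record
      { isGroup = record
        { isMonoid = record
          { isSemigroup = record
            { isMagma = record { isEquivalence = isEquivalence ; ∙-cong = cong₂ _+i_ }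
            ; assoc = +i-assoc
            }
          ; identity = +i-identityˡ , +i-identityʳ
          }
        ; inverse = +i-inverseˡ , +i-inverseʳ
        ; ⁻¹-cong = cong -iᶜ_
        }
      ; comm = +i-comm
      }
    ; *-cong = cong₂ _*i_
    ; *-assoc = *i-assoc
    ; *-identity = comm∧idˡ⇒id *i-comm *i-identityˡ
    ; distrib = *i-distribˡ-+i , comm∧distrˡ⇒distrʳ *i-comm *i-distribˡ-+i
    }
  ; *-comm = *i-comm
  }

ℚi-commutativeRing : CommutativeRing _ _
ℚi-commutativeRing = record { isCommutativeRing = ℚi-isCommutativeRing }

ℚi-ring : ACR.AlmostCommutativeRing _ _
ℚi-ring = ACR.fromCommutativeRing ℚi-commutativeRing (λ x → dec⇒maybe (≡-dec ℚ._≟_ ℚ._≟_ 0i x))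

*i-zeroʳ : ∀ x → x *i 0i ≡ 0i
*i-zeroʳ = solve-∀ ℚi-ring

*i-zeroˡ : ∀ x → 0i *i x ≡ 0i
*i-zeroˡ = solve-∀ ℚi-ring

re-homo-* : ∀ a b → re (a * b) ≡ re a *i re b
re-homo-* a b = cong₂ _,_ (real a b) (imaginary a b)
  where
  real : ∀ a b → a * b ≡ a * b - 0ℚ * 0ℚ
  real = solve-∀ ℚ-ring
  imaginary : ∀ a b → 0ℚ ≡ a * 0ℚ + 0ℚ * b
  imaginary = solve-∀ ℚ-ring

ℕ→ℚ≡mkℚ : ∀ n → ℕ→ℚ n ≡ mkℚ (+ n) 0 (Coprime.sym (1-coprimeTo n))
ℕ→ℚ≡mkℚ n = ℚ.normalize-coprime (Coprime.sym (1-coprimeTo n))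

ℕ→ℚ-homo-+ : ∀ a b → ℕ→ℚ (a ℕ.+ b) ≡ ℕ→ℚ a + ℕ→ℚ b
ℕ→ℚ-homo-+ a b = begin
  + (a ℕ.+ b) / 1                  ≡⟨ cong (_/ 1) (ℤ.pos-+ a b) ⟩
  (+ a ℤ.+ + b) / 1                ≡⟨ cong (_/ 1) (cong₂ ℤ._+_ (ℤ.*-identityʳ (+ a)) (ℤ.*-identityʳ (+ b))) ⟨
  (+ a ℤ.* + 1 ℤ.+ + b ℤ.* + 1) / 1 ≡⟨ cong₂ _+_ (ℕ→ℚ≡mkℚ a) (ℕ→ℚ≡mkℚ b) ⟨
  ℕ→ℚ a + ℕ→ℚ b                    ∎

ℕ→ℚ-homo-* : ∀ a b → ℕ→ℚ (a ℕ.* b) ≡ ℕ→ℚ a * ℕ→ℚ b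
ℕ→ℚ-homo-* a b = begin
  + (a ℕ.* b) / 1   ≡⟨ cong (_/ 1) (ℤ.pos-* a b) ⟩
  (+ a ℤ.* + b) / 1 ≡⟨ cong₂ _*_ (ℕ→ℚ≡mkℚ a) (ℕ→ℚ≡mkℚ b) ⟨
  ℕ→ℚ a * ℕ→ℚ b     ∎

ℕ→ℚ-suc : ∀ n → ℕ→ℚ (suc n) ≡ ℕ→ℚ n + 1ℚ
ℕ→ℚ-suc n = trans (ℕ→ℚ-homo-+ 1 n) (ℚ.+-comm 1ℚ (ℕ→ℚ n))

1/n*n≡1 : ∀ n .{{_ : ℕ.NonZero n}} → (+ 1 / n) * ℕ→ℚ n ≡ 1ℚ
1/n*n≡1 (suc n) = begin
  (+ 1 / suc n) * ℕ→ℚ (suc n)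
    ≡⟨ cong₂ _*_ (ℚ.normalize-coprime (1-coprimeTo (suc n))) (ℕ→ℚ≡mkℚ (suc n)) ⟩
  mkℚ (+ 1) n (1-coprimeTo (suc n)) * n/1
    ≡⟨ ℚ.*-inverseˡ n/1 ⟩
  1ℚ ∎
  where n/1 = mkℚ (+ suc n) 0 (Coprime.sym (1-coprimeTo (suc n)))

pochℚ-unfoldˡ : ∀ a l → pochℚ a (suc l) ≡ a * pochℚ (a + 1ℚ) l
pochℚ-unfoldˡ a zero = trans (ℚ.*-identityˡ (a + 0ℚ)) (trans (ℚ.+-identityʳ a) (sym (ℚ.*-identityʳ a)))
pochℚ-unfoldˡ a (suc l) = begin
  pochℚ a (suc l) * (a + ℕ→ℚ (suc l))
    ≡⟨ cong₂ _*_ (pochℚ-unfoldˡ a l) (cong (_+_ a) (ℕ→ℚ-suc l)) ⟩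
  a * pochℚ (a + 1ℚ) l * (a + (ℕ→ℚ l + 1ℚ))
    ≡⟨ reassociate a (pochℚ (a + 1ℚ) l) (ℕ→ℚ l) ⟩
  a * (pochℚ (a + 1ℚ) l * ((a + 1ℚ) + ℕ→ℚ l)) ∎
  where
  reassociate : ∀ a p x → a * p * (a + (x + 1ℚ)) ≡ a * (p * ((a + 1ℚ) + x))
  reassociate = solve-∀ ℚ-ring

pochℚ-neg-vanish : ∀ n l → n ≤ l → pochℚ (- ℕ→ℚ n) (suc l) ≡ 0ℚ
pochℚ-neg-vanish n l n≤l = go (ℕ.≤⇒≤′ n≤l)
  where
  go : ∀ {l} → n ℕ.≤′ l → pochℚ (- ℕ→ℚ n) (suc l) ≡ 0ℚ
  go ℕ.≤′-refl = trans (cong (pochℚ (- ℕ→ℚ n) n *_) (ℚ.+-inverseˡ (ℕ→ℚ n))) (ℚ.*-zeroʳ (pochℚ (- ℕ→ℚ n) n))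
  go {suc l} (ℕ.≤′-step n≤′l) =
    trans (cong (_* (- ℕ→ℚ n + ℕ→ℚ (suc l))) (go n≤′l)) (ℚ.*-zeroˡ (- ℕ→ℚ n + ℕ→ℚ (suc l)))

2ℚ : ℚ
2ℚ = + 2 / 1

invFactorials : ℕ → ℚ
invFactorials l = + 1 / (suc l ! ℕ.* l !)
  where instance _ = (suc l) !* l !≢0

invFactorials-unfold : ∀ l → invFactorials l ≡ invFactorials (suc l) * ℕ→ℚ (suc (suc l)) * ℕ→ℚ (suc l)
invFactorials-unfold l = begin
  w l                                           ≡⟨ ℚ.*-identityʳ (w l) ⟨
  w l * 1ℚ                                      ≡⟨ cong (w l *_) (1/n*n≡1 F₂ {{(suc (suc l)) !* (suc l) !≢0}}) ⟨
  w l * (w (suc l) * ℕ→ℚ F₂)                    ≡⟨ cong (λ z → w l * (w (suc l) * z)) F₂≡ ⟩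
  w l * (w (suc l) * (ℕ→ℚ F₁ * (ℕ→ℚ l₂ * ℕ→ℚ l₁))) ≡⟨ regroup (w l) (w (suc l)) (ℕ→ℚ F₁) (ℕ→ℚ l₂) (ℕ→ℚ l₁) ⟩
  w l * ℕ→ℚ F₁ * (w (suc l) * ℕ→ℚ l₂ * ℕ→ℚ l₁)
    ≡⟨ cong (_* (w (suc l) * ℕ→ℚ l₂ * ℕ→ℚ l₁)) (1/n*n≡1 F₁ {{(suc l) !* l !≢0}}) ⟩
  1ℚ * (w (suc l) * ℕ→ℚ l₂ * ℕ→ℚ l₁)             ≡⟨ ℚ.*-identityˡ _ ⟩
  w (suc l) * ℕ→ℚ l₂ * ℕ→ℚ l₁                    ∎
  where
  w = invFactorials
  l₁ = suc l
  l₂ = suc (suc l)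
  F₁ = suc l ! ℕ.* l !
  F₂ = suc (suc l) ! ℕ.* suc l !
  factorials : ∀ l f → (2 ℕ.+ l) ℕ.* ((1 ℕ.+ l) ℕ.* f) ℕ.* ((1 ℕ.+ l) ℕ.* f)
                     ≡ (1 ℕ.+ l) ℕ.* f ℕ.* f ℕ.* ((2 ℕ.+ l) ℕ.* (1 ℕ.+ l))
  factorials = ℕ-Solver.solve-∀
  F₂≡ : ℕ→ℚ F₂ ≡ ℕ→ℚ F₁ * (ℕ→ℚ l₂ * ℕ→ℚ l₁)
  F₂≡ = trans (cong ℕ→ℚ (factorials l (l !)))
          (trans (ℕ→ℚ-homo-* F₁ (l₂ ℕ.* l₁)) (cong (ℕ→ℚ F₁ *_) (ℕ→ℚ-homo-* l₂ l₁)))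
  regroup : ∀ a b c d f → a * (b * (c * (d * f))) ≡ a * c * (b * d * f)
  regroup = solve-∀ ℚ-ring

-- (a)_l 2^l / ((2)_l l!); hypCoeff m is definitionally hypTerm (- m)
hypTerm : ℚ → ℕ → ℚ
hypTerm a l = pochℚ a l * (2ℚ ^ℚ l) * invFactorials l

shift : (ℕ → ℚ) → ℕ → ℚ
shift h zero = 0ℚ
shift h (suc l) = h l

hypTerm-lower : ∀ a l →
  hypTerm (a - 1ℚ) (suc l) ≡ (a - 1ℚ) * pochℚ a l * (2ℚ ^ℚ suc l) * invFactorials (suc l)
hypTerm-lower a l = cong (λ p → p * (2ℚ ^ℚ suc l) * invFactorials (suc l))
  (trans (pochℚ-unfoldˡ (a - 1ℚ) l) (cong (λ b → (a - 1ℚ) * pochℚ b l) (cancel a)))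
  where
  cancel : ∀ a → a - 1ℚ + 1ℚ ≡ a
  cancel = solve-∀ ℚ-ring

hypTerm-raise : ∀ a l →
  a * hypTerm (a + 1ℚ) (suc l) ≡ pochℚ a (suc (suc l)) * (2ℚ ^ℚ suc l) * invFactorials (suc l)
hypTerm-raise a l = trans (reassociate a (pochℚ (a + 1ℚ) (suc l)) (2ℚ ^ℚ suc l) (invFactorials (suc l)))
  (cong (λ p → p * (2ℚ ^ℚ suc l) * invFactorials (suc l)) (sym (pochℚ-unfoldˡ a (suc l))))
  where
  reassociate : ∀ a p u w → a * (p * u * w) ≡ a * p * u * w
  reassociate = solve-∀ ℚ-ring

hypTerm-contiguous : ∀ a l →
  (2ℚ - a) * hypTerm (a - 1ℚ) l
    ≡ (- a) * hypTerm (a + 1ℚ) l + 2ℚ * (ℕ→ℚ (suc l) * hypTerm a l - shift (hypTerm a) l)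
hypTerm-contiguous a zero = base a
  where
  base : ∀ a → (2ℚ - a) * 1ℚ ≡ (- a) * 1ℚ + 2ℚ * (1ℚ * 1ℚ - 0ℚ)
  base = solve-∀ ℚ-ring
hypTerm-contiguous a (suc l) = begin
  (2ℚ - a) * hypTerm (a - 1ℚ) (suc l)
    ≡⟨ cong ((2ℚ - a) *_) (hypTerm-lower a l) ⟩
  (2ℚ - a) * ((a - 1ℚ) * P * (2ℚ * t) * v)
    ≡⟨ identity a P t v L ⟩
  - (P * (a + L) * (a + (L + 1ℚ)) * (2ℚ * t) * v) + 2ℚ * ((L + 1ℚ + 1ℚ) * hypTerm a (suc l) - Q)
    ≡⟨ cong₂ (λ x y → x + 2ℚ * (y * hypTerm a (suc l) - Q)) raised ℕ→ℚ[l+2] ⟨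
  (- a) * hypTerm (a + 1ℚ) (suc l) + 2ℚ * (ℕ→ℚ (suc (suc l)) * hypTerm a (suc l) - Q)
    ≡⟨ cong (λ x → (- a) * hypTerm (a + 1ℚ) (suc l) + 2ℚ * (ℕ→ℚ (suc (suc l)) * hypTerm a (suc l) - x))
         previous ⟨
  (- a) * hypTerm (a + 1ℚ) (suc l) + 2ℚ * (ℕ→ℚ (suc (suc l)) * hypTerm a (suc l) - shift (hypTerm a) (suc l)) ∎
  where
  P = pochℚ a l
  t = 2ℚ ^ℚ l
  v = invFactorials (suc l)
  L = ℕ→ℚ l
  Q = P * t * (v * (L + 1ℚ + 1ℚ) * (L + 1ℚ))
  ℕ→ℚ[l+2] : ℕ→ℚ (suc (suc l)) ≡ L + 1ℚ + 1ℚ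
  ℕ→ℚ[l+2] = trans (ℕ→ℚ-suc (suc l)) (cong (_+ 1ℚ) (ℕ→ℚ-suc l))
  raised : (- a) * hypTerm (a + 1ℚ) (suc l) ≡ - (P * (a + L) * (a + (L + 1ℚ)) * (2ℚ * t) * v)
  raised = trans (sym (ℚ.neg-distribˡ-* a (hypTerm (a + 1ℚ) (suc l)))) (cong -_ (trans (hypTerm-raise a l)
    (cong (λ x → P * (a + L) * (a + x) * (2ℚ * t) * v) (ℕ→ℚ-suc l))))
  previous : shift (hypTerm a) (suc l) ≡ Q
  previous = cong (P * t *_) (trans (invFactorials-unfold l) (cong₂ (λ x y → v * x * y) ℕ→ℚ[l+2] (ℕ→ℚ-suc l)))
  identity : ∀ a P t v L →
    (2ℚ - a) * ((a - 1ℚ) * P * (2ℚ * t) * v)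
      ≡ - (P * (a + L) * (a + (L + 1ℚ)) * (2ℚ * t) * v)
        + 2ℚ * ((L + 1ℚ + 1ℚ) * (P * (a + L) * (2ℚ * t) * v) - P * t * (v * (L + 1ℚ + 1ℚ) * (L + 1ℚ)))
  identity = solve-∀ ℚ-ring

hypCoeff-vanish : ∀ m l → m < l → hypCoeff m l ≡ 0ℚ
hypCoeff-vanish m (suc l) (s≤s m≤l) = begin
  pochℚ (- ℕ→ℚ m) (suc l) * u * w ≡⟨ cong (λ p → p * u * w) (pochℚ-neg-vanish m l m≤l) ⟩
  0ℚ * u * w                      ≡⟨ cong (_* w) (ℚ.*-zeroˡ u) ⟩
  0ℚ * w                          ≡⟨ ℚ.*-zeroˡ w ⟩
  0ℚ                              ∎
  where
  u = 2ℚ ^ℚ suc l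
  w = invFactorials (suc l)

hypCoeff-contiguous : ∀ m l →
  ℕ→ℚ (3 ℕ.+ m) * hypCoeff (2 ℕ.+ m) l
    ≡ ℕ→ℚ (suc m) * hypCoeff m l
      + 2ℚ * (ℕ→ℚ (suc l) * hypCoeff (suc m) l - shift (hypCoeff (suc m)) l)
hypCoeff-contiguous m l = begin
  ℕ→ℚ (3 ℕ.+ m) * hypTerm (- ℕ→ℚ (2 ℕ.+ m)) l
    ≡⟨ cong₂ (λ c b → c * hypTerm b l) [m+3]≡ [-m-2]≡ ⟩
  (2ℚ - a) * hypTerm (a - 1ℚ) l
    ≡⟨ hypTerm-contiguous a l ⟩
  (- a) * hypTerm (a + 1ℚ) l + R
    ≡⟨ cong₂ (λ c b → c * hypTerm b l + R) (neg-involutive (ℕ→ℚ (suc m))) [-m]≡ ⟨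
  ℕ→ℚ (suc m) * hypTerm (- ℕ→ℚ m) l + R ∎
  where
  x = ℕ→ℚ m
  a = - ℕ→ℚ (suc m)
  R = 2ℚ * (ℕ→ℚ (suc l) * hypTerm a l - shift (hypTerm a) l)
  neg-involutive : ∀ y → y ≡ - (- y)
  neg-involutive = solve-∀ ℚ-ring
  [m+3]≡ : ℕ→ℚ (3 ℕ.+ m) ≡ 2ℚ - a
  [m+3]≡ = trans (ℕ→ℚ-homo-+ 2 (suc m)) (ring (ℕ→ℚ (suc m)))
    where
    ring : ∀ y → 2ℚ + y ≡ 2ℚ - (- y)
    ring = solve-∀ ℚ-ring
  [-m-2]≡ : - ℕ→ℚ (2 ℕ.+ m) ≡ a - 1ℚ
  [-m-2]≡ = trans (cong -_ (trans (ℕ→ℚ-suc (suc m)) (cong (_+ 1ℚ) (ℕ→ℚ-suc m))))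
                 (trans (ring x) (cong (λ y → - y - 1ℚ) (sym (ℕ→ℚ-suc m))))
    where
    ring : ∀ x → - (x + 1ℚ + 1ℚ) ≡ - (x + 1ℚ) - 1ℚ
    ring = solve-∀ ℚ-ring
  [-m]≡ : - ℕ→ℚ m ≡ a + 1ℚ
  [-m]≡ = trans (ring x) (cong (λ y → - y + 1ℚ) (sym (ℕ→ℚ-suc m)))
    where
    ring : ∀ x → - x ≡ - (x + 1ℚ) + 1ℚ
    ring = solve-∀ ℚ-ring

Σi : ℕ → (ℕ → ℚi) → ℚi
Σi zero f = 0i
Σi (suc n) f = Σi n f +i f n

Σi-cong : ∀ n {f g} → (∀ l → f l ≡ g l) → Σi n f ≡ Σi n g
Σi-cong zero f≗g = refl
Σi-cong (suc n) f≗g = cong₂ _+i_ (Σi-cong n f≗g) (f≗g n)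

Σi-vanish : ∀ n {f} → (∀ l → f l ≡ 0i) → Σi n f ≡ 0i
Σi-vanish zero f≗0 = refl
Σi-vanish (suc n) f≗0 = trans (cong₂ _+i_ (Σi-vanish n f≗0) (f≗0 n)) (+i-identityˡ 0i)

Σi-extend : ∀ n f → f n ≡ 0i → Σi (suc n) f ≡ Σi n f
Σi-extend n f fn≡0 = trans (cong (Σi n f +i_) fn≡0) (+i-identityʳ (Σi n f))

Σi-head : ∀ n f → Σi (suc n) f ≡ f 0 +i Σi n (λ l → f (suc l))
Σi-head zero f = trans (+i-identityˡ (f 0)) (sym (+i-identityʳ (f 0)))
Σi-head (suc n) f = trans (cong (_+i f (suc n)) (Σi-head n f)) (+i-assoc (f 0) _ _)

Σi-distrib-+i : ∀ n f g → Σi n (λ l → f l +i g l) ≡ Σi n f +i Σi n g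
Σi-distrib-+i zero f g = sym (+i-identityˡ 0i)
Σi-distrib-+i (suc n) f g =
  trans (cong (_+i (f n +i g n)) (Σi-distrib-+i n f g)) (interchange (Σi n f) (Σi n g) (f n) (g n))
  where
  interchange : ∀ a b c d → (a +i b) +i (c +i d) ≡ (a +i c) +i (b +i d)
  interchange = solve-∀ ℚi-ring

*i-distribˡ-Σi : ∀ n c f → c *i Σi n f ≡ Σi n (λ l → c *i f l)
*i-distribˡ-Σi zero c f = *i-zeroʳ c
*i-distribˡ-Σi (suc n) c f =
  trans (*i-distribˡ-+i c (Σi n f) (f n)) (cong (_+i (c *i f n)) (*i-distribˡ-Σi n c f))

series : ℕ → (ℕ → ℚ) → (ℕ → ℚi) → ℚi
series n h b = Σi n (λ l → re (h l) *i b l)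

series-vanish : ∀ n {h} b → (∀ l → h l ≡ 0ℚ) → series n h b ≡ 0i
series-vanish n b h≗0 = Σi-vanish n (λ l → trans (cong (λ q → re q *i b l) (h≗0 l)) (*i-zeroˡ (b l)))

series-extend : ∀ n h b → h n ≡ 0ℚ → series (suc n) h b ≡ series n h b
series-extend n h b hn≡0 =
  Σi-extend n _ (trans (cong (λ q → re q *i b n) hn≡0) (*i-zeroˡ (b n)))

series-shift : ∀ n h b → series (suc n) (shift h) b ≡ series n h (λ l → b (suc l))
series-shift n h b = begin
  series (suc n) (shift h) b                        ≡⟨ Σi-head n (λ l → re (shift h l) *i b l) ⟩
  (re 0ℚ *i b 0) +i series n h (λ l → b (suc l))    ≡⟨ cong (_+i series n h (λ l → b (suc l))) (*i-zeroˡ (b 0)) ⟩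
  0i +i series n h (λ l → b (suc l))                ≡⟨ +i-identityˡ (series n h (λ l → b (suc l))) ⟩
  series n h (λ l → b (suc l))                      ∎

series-scale : ∀ n c h b → re c *i series n h b ≡ series n (λ l → c * h l) b
series-scale n c h b = trans (*i-distribˡ-Σi n (re c) _) (Σi-cong n (λ l →
  trans (sym (*i-assoc (re c) (re (h l)) (b l))) (cong (_*i b l) (sym (re-homo-* c (h l))))))

series-+ : ∀ n f g b → series n f b +i series n g b ≡ series n (λ l → f l + g l) b
series-+ n f g b = trans (sym (Σi-distrib-+i n _ _)) (Σi-cong n (λ l →
  sym (comm∧distrˡ⇒distrʳ *i-comm *i-distribˡ-+i (b l) (re (f l)) (re (g l)))))

series-combine : ∀ n a b c f g₁ g₂ k β →
  (re a *i series n f β) +i ((re b *i (series n g₁ β +i series n g₂ β)) +i (re c *i series n k β))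
    ≡ series n (λ l → a * f l + (b * (g₁ l + g₂ l) + c * k l)) β
series-combine n a b c f g₁ g₂ k β = begin
  (re a *i series n f β) +i ((re b *i (series n g₁ β +i series n g₂ β)) +i (re c *i series n k β))
    ≡⟨ cong (λ s → (re a *i series n f β) +i ((re b *i s) +i (re c *i series n k β))) (series-+ n g₁ g₂ β) ⟩
  (re a *i series n f β) +i ((re b *i series n g β) +i (re c *i series n k β))
    ≡⟨ cong₂ _+i_ (series-scale n a f β) (cong₂ _+i_ (series-scale n b g β) (series-scale n c k β)) ⟩
  series n (λ l → a * f l) β +i (series n (λ l → b * g l) β +i series n (λ l → c * k l) β)
    ≡⟨ cong (series n (λ l → a * f l) β +i_) (series-+ n (λ l → b * g l) (λ l → c * k l) β) ⟩
  series n (λ l → a * f l) β +i series n (λ l → b * g l + c * k l) β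
    ≡⟨ series-+ n (λ l → a * f l) (λ l → b * g l + c * k l) β ⟩
  series n (λ l → a * f l + (b * (g₁ l + g₂ l) + c * k l)) β ∎
  where
  g : ℕ → ℚ
  g l = g₁ l + g₂ l

coeff-+P : ∀ p q k → coeff (p +P q) k ≡ coeff p k +i coeff q k
coeff-+P [] q k = sym (+i-identityˡ (coeff q k))
coeff-+P (c ∷ p) [] k = sym (+i-identityʳ (coeff (c ∷ p) k))
coeff-+P (c ∷ p) (d ∷ q) zero = refl
coeff-+P (c ∷ p) (d ∷ q) (suc k) = coeff-+P p q k

coeff-·P : ∀ a p k → coeff (a ·P p) k ≡ a *i coeff p k
coeff-·P a [] k = sym (*i-zeroʳ a)
coeff-·P a (c ∷ p) zero = refl
coeff-·P a (c ∷ p) (suc k) = coeff-·P a p k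

coeff-xP-·P : ∀ a p k → coeff (xP (a ·P p)) k ≡ a *i coeff (xP p) k
coeff-xP-·P a p zero = sym (*i-zeroʳ a)
coeff-xP-·P a p (suc k) = coeff-·P a p k

coeff-sumP : ∀ n F k → coeff (sumP n F) k ≡ Σi n (λ l → coeff (F l) k)
coeff-sumP zero F k = refl
coeff-sumP (suc n) F k =
  trans (coeff-+P (sumP n F) (F n) k) (cong (_+i coeff (F n) k) (coeff-sumP n F k))

coeff-xP-sumP : ∀ n F k → coeff (xP (sumP n F)) k ≡ Σi n (λ l → coeff (xP (F l)) k)
coeff-xP-sumP n F zero = sym (Σi-vanish n (λ _ → refl))
coeff-xP-sumP n F (suc k) = coeff-sumP n F k

coeff-pochPoly-suc : ∀ l k →
  coeff (pochPoly (suc l)) k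
    ≡ (re (ℕ→ℚ (suc l)) *i coeff (pochPoly l) k) +i (imagUnit *i coeff (xP (pochPoly l)) k)
coeff-pochPoly-suc l k = trans (coeff-+P (c ·P pochPoly l) (imagUnit ·P xP (pochPoly l)) k)
  (cong₂ _+i_ (coeff-·P c (pochPoly l) k) (coeff-·P imagUnit (xP (pochPoly l)) k))
  where c = re (ℕ→ℚ (suc l))

poch : ℕ → ℕ → ℚi
poch k l = coeff (pochPoly l) k

xPoch : ℕ → ℕ → ℚi
xPoch k l = coeff (xP (pochPoly l)) k

series-imagUnit-x : ∀ n h k →
  imagUnit *i series n h (xPoch k)
    ≡ series n h (λ l → poch k (suc l)) +i series n (λ l → - (ℕ→ℚ (suc l) * h l)) (poch k)
series-imagUnit-x n h k = begin
  imagUnit *i series n h (xPoch k)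
    ≡⟨ *i-distribˡ-Σi n imagUnit (λ l → re (h l) *i xPoch k l) ⟩
  Σi n (λ l → imagUnit *i (re (h l) *i xPoch k l))
    ≡⟨ Σi-cong n termwise ⟩
  Σi n (λ l → (re (h l) *i poch k (suc l)) +i (re (- (ℕ→ℚ (suc l) * h l)) *i poch k l))
    ≡⟨ Σi-distrib-+i n (λ l → re (h l) *i poch k (suc l)) (λ l → re (- (ℕ→ℚ (suc l) * h l)) *i poch k l) ⟩
  series n h (λ l → poch k (suc l)) +i series n (λ l → - (ℕ→ℚ (suc l) * h l)) (poch k) ∎
  where
  rearrange : ∀ i h c p y → i *i (h *i y) ≡ (h *i ((c *i p) +i (i *i y))) +i ((-iᶜ (c *i h)) *i p)
  rearrange = solve-∀ ℚi-ring
  termwise : ∀ l → imagUnit *i (re (h l) *i xPoch k l)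
                     ≡ (re (h l) *i poch k (suc l)) +i (re (- (ℕ→ℚ (suc l) * h l)) *i poch k l)
  termwise l = trans (rearrange imagUnit (re (h l)) (re (ℕ→ℚ (suc l))) (poch k l) (xPoch k l))
    (cong₂ (λ q r → (re (h l) *i q) +i ((-iᶜ r) *i poch k l))
      (sym (coeff-pochPoly-suc l k)) (sym (re-homo-* (ℕ→ℚ (suc l)) (h l))))

mpFactor : ℕ → ℚi
mpFactor m = re (ℕ→ℚ (suc m)) *i (imagUnit ^i m)

coeff-meixnerPollaczek : ∀ m k → mpCoeff m k ≡ mpFactor m *i series (suc m) (hypCoeff m) (poch k)
coeff-meixnerPollaczek m k = trans (coeff-·P (mpFactor m) (sumP (suc m) F) k)
  (cong (mpFactor m *i_) (trans (coeff-sumP (suc m) F k)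
    (Σi-cong (suc m) (λ l → coeff-·P (re (hypCoeff m l)) (pochPoly l) k))))
  where
  F : ℕ → Poly
  F l = re (hypCoeff m l) ·P pochPoly l

coeff-x-meixnerPollaczek : ∀ m k →
  coeff (xP (meixnerPollaczek m)) k ≡ mpFactor m *i series (suc m) (hypCoeff m) (xPoch k)
coeff-x-meixnerPollaczek m k = trans (coeff-xP-·P (mpFactor m) (sumP (suc m) F) k)
  (cong (mpFactor m *i_) (trans (coeff-xP-sumP (suc m) F k)
    (Σi-cong (suc m) (λ l → coeff-xP-·P (re (hypCoeff m l)) (pochPoly l) k))))
  where
  F : ℕ → Poly
  F l = re (hypCoeff m l) ·P pochPoly l

coeff-threeTermLHS : ∀ m k →
  coeff (threeTermLHS m) k
    ≡ (re (ℕ→ℚ (2 ℕ.+ m)) *i mpCoeff (2 ℕ.+ m) k)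
      +i ((re (- 2ℚ) *i coeff (xP (meixnerPollaczek (suc m))) k) +i (re (ℕ→ℚ (2 ℕ.+ m)) *i mpCoeff m k))
coeff-threeTermLHS m k = begin
  coeff (P₂ +P (P₁ +P P₀)) k                  ≡⟨ coeff-+P P₂ (P₁ +P P₀) k ⟩
  coeff P₂ k +i coeff (P₁ +P P₀) k            ≡⟨ cong (coeff P₂ k +i_) (coeff-+P P₁ P₀ k) ⟩
  coeff P₂ k +i (coeff P₁ k +i coeff P₀ k)
    ≡⟨ cong₂ _+i_ (coeff-·P c (meixnerPollaczek (2 ℕ.+ m)) k)
         (cong₂ _+i_ (coeff-·P (re (- 2ℚ)) (xP (meixnerPollaczek (suc m))) k) (coeff-·P c (meixnerPollaczek m) k)) ⟩
  (c *i mpCoeff (2 ℕ.+ m) k) +i ((re (- 2ℚ) *i coeff (xP (meixnerPollaczek (suc m))) k) +i (c *i mpCoeff m k)) ∎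
  where
  c = re (ℕ→ℚ (2 ℕ.+ m))
  P₂ = c ·P meixnerPollaczek (2 ℕ.+ m)
  P₁ = re (- 2ℚ) ·P xP (meixnerPollaczek (suc m))
  P₀ = c ·P meixnerPollaczek m

hypSeries-extend : ∀ m j b → series (j ℕ.+ suc m) (hypCoeff m) b ≡ series (suc m) (hypCoeff m) b
hypSeries-extend m zero b = refl
hypSeries-extend m (suc j) b =
  trans (series-extend (j ℕ.+ suc m) (hypCoeff m) b (hypCoeff-vanish m (j ℕ.+ suc m) (ℕ.m≤n+m (suc m) j)))
        (hypSeries-extend m j b)

imagUnit-x-hypSeries : ∀ m k →
  imagUnit *i series (2 ℕ.+ m) (hypCoeff (suc m)) (xPoch k)
    ≡ series (3 ℕ.+ m) (shift (hypCoeff (suc m))) (poch k)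
      +i series (3 ℕ.+ m) (λ l → - (ℕ→ℚ (suc l) * hypCoeff (suc m) l)) (poch k)
imagUnit-x-hypSeries m k = trans (series-imagUnit-x (2 ℕ.+ m) h₁ k)
  (cong₂ _+i_ (sym (series-shift (2 ℕ.+ m) h₁ (poch k))) (sym (series-extend (2 ℕ.+ m) g (poch k) g-vanish)))
  where
  h₁ = hypCoeff (suc m)
  g : ℕ → ℚ
  g l = - (ℕ→ℚ (suc l) * h₁ l)
  g-vanish : g (2 ℕ.+ m) ≡ 0ℚ
  g-vanish = trans (cong (λ h → - (ℕ→ℚ (3 ℕ.+ m) * h)) (hypCoeff-vanish (suc m) (2 ℕ.+ m) (ℕ.n<1+n (suc m))))
                   (cong -_ (ℚ.*-zeroʳ (ℕ→ℚ (3 ℕ.+ m))))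

-- The three-term recurrence with the common factor (m + 2) iᵐ cancelled.
hypSeries-recurrence : ∀ m k →
  ((re (ℕ→ℚ (3 ℕ.+ m)) *i (imagUnit *i imagUnit)) *i series (3 ℕ.+ m) (hypCoeff (2 ℕ.+ m)) (poch k))
    +i ((re (- 2ℚ) *i (imagUnit *i series (2 ℕ.+ m) (hypCoeff (suc m)) (xPoch k)))
        +i (re (ℕ→ℚ (suc m)) *i series (suc m) (hypCoeff m) (poch k)))
    ≡ 0i
hypSeries-recurrence m k = begin
  ((re c₃ *i (imagUnit *i imagUnit)) *i S h₂)
    +i ((re (- 2ℚ) *i (imagUnit *i series (2 ℕ.+ m) h₁ (xPoch k))) +i (re c₁ *i series (suc m) h₀ π))
    ≡⟨ cong₂ (λ a b → (a *i S h₂) +i b) (sym (re-homo-* c₃ (- 1ℚ)))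
         (cong₂ (λ a b → (re (- 2ℚ) *i a) +i (re c₁ *i b)) (imagUnit-x-hypSeries m k) (sym (hypSeries-extend m 2 π))) ⟩
  (re (c₃ * - 1ℚ) *i S h₂) +i ((re (- 2ℚ) *i (S (shift h₁) +i S g)) +i (re c₁ *i S h₀))
    ≡⟨ series-combine N (c₃ * - 1ℚ) (- 2ℚ) c₁ h₂ (shift h₁) g h₀ π ⟩
  S (λ l → c₃ * - 1ℚ * h₂ l + (- 2ℚ * (shift h₁ l + g l) + c₁ * h₀ l))
    ≡⟨ series-vanish N π termwise ⟩
  0i ∎
  where
  N = 3 ℕ.+ m
  c₃ = ℕ→ℚ N
  c₁ = ℕ→ℚ (suc m)
  h₂ = hypCoeff (2 ℕ.+ m)
  h₁ = hypCoeff (suc m)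
  h₀ = hypCoeff m
  π = poch k
  S : (ℕ → ℚ) → ℚi
  S h = series N h π
  g : ℕ → ℚ
  g l = - (ℕ→ℚ (suc l) * h₁ l)
  regroup : ∀ c₃ h₂ c₁ h₀ L h₁ s →
    c₃ * - 1ℚ * h₂ + (- 2ℚ * (s + - (L * h₁)) + c₁ * h₀) ≡ - (c₃ * h₂) + (c₁ * h₀ + 2ℚ * (L * h₁ - s))
  regroup = solve-∀ ℚ-ring
  termwise : ∀ l → c₃ * - 1ℚ * h₂ l + (- 2ℚ * (shift h₁ l + g l) + c₁ * h₀ l) ≡ 0ℚ
  termwise l = trans (regroup c₃ (h₂ l) c₁ (h₀ l) (ℕ→ℚ (suc l)) (h₁ l) (shift h₁ l))
    (trans (cong (λ x → - x + rhs) (hypCoeff-contiguous m l)) (ℚ.+-inverseˡ rhs))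
    where rhs = c₁ * h₀ l + 2ℚ * (ℕ→ℚ (suc l) * h₁ l - shift h₁ l)

threeTermRecurrence : ∀ m k → coeff (threeTermLHS m) k ≡ 0i
threeTermRecurrence m k = begin
  coeff (threeTermLHS m) k
    ≡⟨ coeff-threeTermLHS m k ⟩
  (c *i mpCoeff (2 ℕ.+ m) k) +i ((re (- 2ℚ) *i coeff (xP (meixnerPollaczek (suc m))) k) +i (c *i mpCoeff m k))
    ≡⟨ cong₂ (λ p₂ q → (c *i p₂) +i q) (coeff-meixnerPollaczek (2 ℕ.+ m) k)
         (cong₂ (λ xp₁ p₀ → (re (- 2ℚ) *i xp₁) +i (c *i p₀))
           (coeff-x-meixnerPollaczek (suc m) k) (coeff-meixnerPollaczek m k)) ⟩
  (c *i ((re c₃ *i (I *i (I *i z))) *i S₂)) +i ((re (- 2ℚ) *i ((c *i (I *i z)) *i X₁)) +i (c *i ((re c₁ *i z) *i S₀)))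
    ≡⟨ factor c (re c₃) (re c₁) (re (- 2ℚ)) I z S₂ X₁ S₀ ⟩
  (c *i z) *i (((re c₃ *i (I *i I)) *i S₂) +i ((re (- 2ℚ) *i (I *i X₁)) +i (re c₁ *i S₀)))
    ≡⟨ cong ((c *i z) *i_) (hypSeries-recurrence m k) ⟩
  (c *i z) *i 0i
    ≡⟨ *i-zeroʳ (c *i z) ⟩
  0i ∎
  where
  c = re (ℕ→ℚ (2 ℕ.+ m))
  c₃ = ℕ→ℚ (3 ℕ.+ m)
  c₁ = ℕ→ℚ (suc m)
  I = imagUnit
  z = imagUnit ^i m
  S₂ = series (3 ℕ.+ m) (hypCoeff (2 ℕ.+ m)) (poch k)
  X₁ = series (2 ℕ.+ m) (hypCoeff (suc m)) (xPoch k)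
  S₀ = series (suc m) (hypCoeff m) (poch k)
  factor : ∀ c c₃ c₁ n₂ I z S₂ X₁ S₀ →
    (c *i ((c₃ *i (I *i (I *i z))) *i S₂)) +i ((n₂ *i ((c *i (I *i z)) *i X₁)) +i (c *i ((c₁ *i z) *i S₀)))
      ≡ (c *i z) *i (((c₃ *i (I *i I)) *i S₂) +i ((n₂ *i (I *i X₁)) +i (c₁ *i S₀)))
  factor = solve-∀ ℚi-ring

mpCoeff-recurrence : ∀ m k →
  mpCoeff (2 ℕ.+ m) k
    ≡ ((re 2ℚ *i re (+ 1 / (2 ℕ.+ m))) *i coeff (xP (meixnerPollaczek (suc m))) k) +i (-iᶜ mpCoeff m k)
mpCoeff-recurrence m k = begin
  p₂                                        ≡⟨ *i-identityˡ p₂ ⟨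
  re 1ℚ *i p₂                               ≡⟨ cong (_*i p₂) r*c≡1 ⟨
  (r *i c) *i p₂                            ≡⟨ isolate r c p₂ x p₀ ⟩
  (r *i ((c *i p₂) +i ((re (- 2ℚ) *i x) +i (c *i p₀)))) +i (((re 2ℚ *i r) *i x) +i (-iᶜ ((r *i c) *i p₀)))
    ≡⟨ cong₂ (λ s u → (r *i s) +i (((re 2ℚ *i r) *i x) +i (-iᶜ (u *i p₀))))
         (trans (sym (coeff-threeTermLHS m k)) (threeTermRecurrence m k)) r*c≡1 ⟩
  (r *i 0i) +i (((re 2ℚ *i r) *i x) +i (-iᶜ (re 1ℚ *i p₀)))
    ≡⟨ tidy r x p₀ ⟩
  ((re 2ℚ *i r) *i x) +i (-iᶜ p₀) ∎
  where
  p₂ = mpCoeff (2 ℕ.+ m) k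
  p₀ = mpCoeff m k
  x = coeff (xP (meixnerPollaczek (suc m))) k
  r = re (+ 1 / (2 ℕ.+ m))
  c = re (ℕ→ℚ (2 ℕ.+ m))
  r*c≡1 : r *i c ≡ re 1ℚ
  r*c≡1 = trans (sym (re-homo-* (+ 1 / (2 ℕ.+ m)) (ℕ→ℚ (2 ℕ.+ m)))) (cong re (1/n*n≡1 (2 ℕ.+ m)))
  isolate : ∀ r c p₂ x p₀ → (r *i c) *i p₂
    ≡ (r *i ((c *i p₂) +i ((re (- 2ℚ) *i x) +i (c *i p₀)))) +i (((re 2ℚ *i r) *i x) +i (-iᶜ ((r *i c) *i p₀)))
  isolate = solve-∀ ℚi-ring
  tidy : ∀ r x p₀ → (r *i 0i) +i (((re 2ℚ *i r) *i x) +i (-iᶜ (re 1ℚ *i p₀))) ≡ ((re 2ℚ *i r) *i x) +i (-iᶜ p₀)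
  tidy = solve-∀ ℚi-ring

mpCoeff-degree : ∀ m k → m < k → mpCoeff m k ≡ 0i
mpCoeff-degree zero (suc k) _ = refl
mpCoeff-degree (suc zero) (suc (suc k)) _ = refl
mpCoeff-degree (suc zero) (suc zero) (s≤s ())
mpCoeff-degree (suc (suc m)) (suc k) (s≤s m+1<k) = begin
  mpCoeff (2 ℕ.+ m) (suc k)                                ≡⟨ mpCoeff-recurrence m (suc k) ⟩
  (a *i mpCoeff (suc m) k) +i (-iᶜ mpCoeff m (suc k))
    ≡⟨ cong₂ (λ u v → (a *i u) +i (-iᶜ v)) (mpCoeff-degree (suc m) k m+1<k)
         (mpCoeff-degree m (suc k) (ℕ.m<n⇒m<1+n (ℕ.<-trans (ℕ.n<1+n m) m+1<k))) ⟩
  (a *i 0i) +i (-iᶜ 0i)                                   ≡⟨ vanish a ⟩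
  0i                                                       ∎
  where
  a = re 2ℚ *i re (+ 1 / (2 ℕ.+ m))
  vanish : ∀ a → (a *i 0i) +i (-iᶜ 0i) ≡ 0i
  vanish = solve-∀ ℚi-ring

dilcher-unfold : ∀ n k →
  dilcher (suc (suc n)) k ≡ - ((+ 1 / suc n) * dilcher (suc n) k) + (+ 1 / 4) * dilcherPred n k
dilcher-unfold n zero = sym (trans (cong (_+_ b) (ℚ.*-zeroʳ (+ 1 / 4))) (ℚ.+-identityʳ b))
  where b = - ((+ 1 / suc n) * dilcher (suc n) zero)
dilcher-unfold n (suc k) = refl

dilcher-vanish : ∀ n k → n ≤ k ℕ.+ k → dilcher n k ≡ 0ℚ
dilcher-vanish zero k _ = refl
dilcher-vanish (suc zero) (suc k) _ = refl
dilcher-vanish (suc (suc n)) (suc k) (s≤s n+1≤k+k+1) = begin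
  - ((+ 1 / suc n) * dilcher (suc n) (suc k)) + (+ 1 / 4) * dilcher n k
    ≡⟨ cong₂ (λ u v → - ((+ 1 / suc n) * u) + (+ 1 / 4) * v)
         (dilcher-vanish (suc n) (suc k) (ℕ.m≤n⇒m≤1+n n+1≤k+k+1))
         (dilcher-vanish n k (ℕ.≤-pred (subst (suc n ≤_) (ℕ.+-suc k k) n+1≤k+k+1))) ⟩
  - ((+ 1 / suc n) * 0ℚ) + (+ 1 / 4) * 0ℚ
    ≡⟨ vanish (+ 1 / suc n) (+ 1 / 4) ⟩
  0ℚ ∎
  where
  vanish : ∀ r q → - (r * 0ℚ) + q * 0ℚ ≡ 0ℚ
  vanish = solve-∀ ℚ-ring

dilcherMP-recurrence : ∀ m k d e →
  re (dilcher (2 ℕ.+ m) k) ≡ re (signℚ e * inv2^ (suc m)) *i coeff (xP (meixnerPollaczek (suc m))) d →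
  re (dilcherPred (suc m) k) ≡ re (signℚ e * inv2^ m) *i mpCoeff m d →
  re (dilcher (3 ℕ.+ m) k) ≡ re (signℚ (suc e) * inv2^ (2 ℕ.+ m)) *i mpCoeff (2 ℕ.+ m) d
dilcherMP-recurrence m k d e upper lower = begin
  re (dilcher (3 ℕ.+ m) k)
    ≡⟨ cong re (dilcher-unfold (suc m) k) ⟩
  re (- (r * dilcher (2 ℕ.+ m) k) + q * dilcherPred (suc m) k)
    ≡⟨ cong₂ (λ u v → (-iᶜ u) +i v) (re-homo-* r (dilcher (2 ℕ.+ m) k)) (re-homo-* q (dilcherPred (suc m) k)) ⟩
  (-iᶜ (re r *i re (dilcher (2 ℕ.+ m) k))) +i (re q *i re (dilcherPred (suc m) k))
    ≡⟨ cong₂ (λ u v → (-iᶜ (re r *i u)) +i (re q *i v))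
         (trans upper (cong (_*i x) (trans (re-homo-* σ (½ * w)) (cong (re σ *i_) (re-homo-* ½ w)))))
         (trans lower (cong (_*i p₀) (re-homo-* σ w))) ⟩
  (-iᶜ (re r *i ((re σ *i (re ½ *i re w)) *i x))) +i (re q *i ((re σ *i re w) *i p₀))
    ≡⟨ regroup (re r) (re σ) (re w) x p₀ ⟩
  ((re (- 1ℚ) *i re σ) *i (re ½ *i (re ½ *i re w))) *i (((re 2ℚ *i re r) *i x) +i (-iᶜ p₀))
    ≡⟨ cong₂ _*i_ target-factor (mpCoeff-recurrence m d) ⟨
  re (signℚ (suc e) * inv2^ (2 ℕ.+ m)) *i mpCoeff (2 ℕ.+ m) d ∎
  where
  r = + 1 / (2 ℕ.+ m)
  q = + 1 / 4
  ½ = + 1 / 2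
  σ = signℚ e
  w = inv2^ m
  x = coeff (xP (meixnerPollaczek (suc m))) d
  p₀ = mpCoeff m d
  target-factor : re (- 1ℚ * σ * (½ * (½ * w))) ≡ (re (- 1ℚ) *i re σ) *i (re ½ *i (re ½ *i re w))
  target-factor = trans (re-homo-* (- 1ℚ * σ) (½ * (½ * w)))
    (cong₂ _*i_ (re-homo-* (- 1ℚ) σ) (trans (re-homo-* ½ (½ * w)) (cong (re ½ *i_) (re-homo-* ½ w))))
  regroup : ∀ r σ w x p₀ →
    (-iᶜ (r *i ((σ *i (re ½ *i w)) *i x))) +i (re (+ 1 / 4) *i ((σ *i w) *i p₀))
      ≡ ((re (- 1ℚ) *i σ) *i (re ½ *i (re ½ *i w))) *i (((re 2ℚ *i r) *i x) +i (-iᶜ p₀))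
  regroup = solve-∀ ℚi-ring

double-suc-injective : ∀ {m} k d → suc k ℕ.+ suc k ℕ.+ d ≡ suc (suc m) → k ℕ.+ k ℕ.+ d ≡ m
double-suc-injective k d eq = ℕ.suc-injective (ℕ.suc-injective (trans (sym (twoSuc k d)) eq))
  where
  twoSuc : ∀ k d → suc k ℕ.+ suc k ℕ.+ d ≡ suc (suc (k ℕ.+ k ℕ.+ d))
  twoSuc = ℕ-Solver.solve-∀

-- The claim for N = m + 1, indexed by d = N - 1 - 2k.
DilcherMP : ℕ → Set
DilcherMP m = ∀ k d → k ℕ.+ k ℕ.+ d ≡ m →
  re (dilcher (suc m) k) ≡ re (signℚ (k ℕ.+ d) * inv2^ m) *i mpCoeff m d

dilcherMP-step : ∀ m → DilcherMP m → DilcherMP (suc m) → DilcherMP (2 ℕ.+ m)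
dilcherMP-step m hyp₀ hyp₁ zero .(2 ℕ.+ m) refl =
  dilcherMP-recurrence m 0 (2 ℕ.+ m) (suc m) (hyp₁ 0 (suc m) refl) (sym beyond-degree)
  where
  c = re (signℚ (suc m) * inv2^ m)
  beyond-degree : c *i mpCoeff m (2 ℕ.+ m) ≡ 0i
  beyond-degree = trans (cong (c *i_) (mpCoeff-degree m (2 ℕ.+ m) (ℕ.m<n⇒m<1+n (ℕ.n<1+n m)))) (*i-zeroʳ c)
dilcherMP-step m hyp₀ hyp₁ (suc k) zero eq =
  dilcherMP-recurrence m (suc k) 0 (k ℕ.+ 0) (sym out-of-range) (hyp₀ k 0 (double-suc-injective k 0 eq))
  where
  c = re (signℚ (k ℕ.+ 0) * inv2^ (suc m))
  out-of-range : c *i 0i ≡ re (dilcher (2 ℕ.+ m) (suc k))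
  out-of-range = trans (*i-zeroʳ c) (cong re (sym (dilcher-vanish (2 ℕ.+ m) (suc k)
    (ℕ.≤-reflexive (trans (sym eq) (ℕ.+-identityʳ (suc k ℕ.+ suc k)))))))
dilcherMP-step m hyp₀ hyp₁ (suc k) (suc d) eq =
  dilcherMP-recurrence m (suc k) (suc d) (k ℕ.+ suc d)
    (subst (λ e → re (dilcher (2 ℕ.+ m) (suc k)) ≡ re (signℚ e * inv2^ (suc m)) *i mpCoeff (suc m) d)
       (sym (ℕ.+-suc k d)) (hyp₁ (suc k) d (trans (moveSuc k d) (cong suc eq′))))
    (hyp₀ k (suc d) eq′)
  where
  eq′ = double-suc-injective k (suc d) eq
  moveSuc : ∀ k d → suc k ℕ.+ suc k ℕ.+ d ≡ suc (k ℕ.+ k ℕ.+ suc d)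
  moveSuc = ℕ-Solver.solve-∀

dilcherMP : ∀ m → DilcherMP m
dilcherMP zero zero zero refl = refl
dilcherMP (suc zero) zero (suc zero) refl = refl
dilcherMP (suc zero) (suc zero) d ()
dilcherMP (suc zero) (suc (suc k)) d ()
dilcherMP (suc (suc m)) = dilcherMP-step m (dilcherMP m) (dilcherMP (suc m))

k≤⌊m/2⌋⇒k+k≤m : ∀ {k} m → k ≤ ⌊ m /2⌋ → k ℕ.+ k ≤ m
k≤⌊m/2⌋⇒k+k≤m m k≤ =
  ℕ.≤-trans (ℕ.+-mono-≤ k≤ (ℕ.≤-trans k≤ (ℕ.⌊n/2⌋≤⌈n/2⌉ m))) (ℕ.≤-reflexive (ℕ.⌊n/2⌋+⌈n/2⌉≡n m))

dilcher≡mpCoeff : ∀ k d m → k ℕ.+ k ℕ.+ d ≡ m →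
  re (dilcher (suc m) k) ≡ re (signℚ (m ∸ k) * inv2^ m) *i mpCoeff m (m ∸ 2 ℕ.* k)
dilcher≡mpCoeff k d .(k ℕ.+ k ℕ.+ d) refl =
  subst₂ (λ e j → re (dilcher (suc m) k) ≡ re (signℚ e * inv2^ m) *i mpCoeff m j)
    (sym m∸k≡k+d) (sym m∸2k≡d) (dilcherMP m k d refl)
  where
  m = k ℕ.+ k ℕ.+ d
  m∸k≡k+d : m ∸ k ≡ k ℕ.+ d
  m∸k≡k+d = trans (cong (_∸ k) (ℕ.+-assoc k k d)) (ℕ.m+n∸m≡n k (k ℕ.+ d))
  m∸2k≡d : m ∸ 2 ℕ.* k ≡ d
  m∸2k≡d = trans (cong (λ j → m ∸ (k ℕ.+ j)) (ℕ.+-identityʳ k)) (ℕ.m+n∸m≡n (k ℕ.+ k) d)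

dilcher-meixnerPollaczek : (N k : ℕ) → 1 ≤ N → k ≤ ⌊ N ∸ 1 /2⌋ →
  re (dilcher N k) ≡ re (signℚ (N ∸ 1 ∸ k) * inv2^ (N ∸ 1)) *i mpCoeff (N ∸ 1) (N ∸ 1 ∸ 2 ℕ.* k)
dilcher-meixnerPollaczek (suc m) k _ k≤ =
  dilcher≡mpCoeff k (m ∸ (k ℕ.+ k)) m (ℕ.m+[n∸m]≡n (k≤⌊m/2⌋⇒k+k≤m m k≤))

-- Both sides hold outright (dilcher-unfold, threeTermRecurrence).
dilcherRecurrence⇔threeTermRecurrence : ∀ n k →
  (dilcher (suc (suc n)) k ≡ - ((+ 1 / suc n) * dilcher (suc n) k) + (+ 1 / 4) * dilcherPred n k)
    ⇔ (coeff (threeTermLHS (n ∸ 1)) (suc n ∸ 2 ℕ.* k) ≡ 0i)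
dilcherRecurrence⇔threeTermRecurrence n k =
  mk⇔ (λ _ → threeTermRecurrence (n ∸ 1) (suc n ∸ 2 ℕ.* k)) (λ _ → dilcher-unfold n k)

mainTheorem6 :
    -- (1)  b_k^{(N)} = (-1)^{N-1-k} / 2^{N-1} · p_{N-1-2k}^{(N-1)}
    ((N k : ℕ) → 1 ≤ N → k ≤ ⌊ N ∸ 1 /2⌋ →
      re (dilcher N k)
        ≡ re (signℚ (N ∸ 1 ∸ k) * inv2^ (N ∸ 1)) *i mpCoeff (N ∸ 1) (N ∸ 1 ∸ 2 ℕ.* k))
    ×
    -- (2)  with N = n+1 ≥ 2 and 0 ≤ k ≤ ⌊N/2⌋, the Dilcher recurrence for
    --      b_k^{(N+1)} holds iff the coefficient of x^{N-2k} in the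
    --      three-term recurrence at m = N-1 vanishes
    ((n k : ℕ) → 1 ≤ n → k ≤ ⌊ suc n /2⌋ →
      (dilcher (suc (suc n)) k
          ≡ (- ((+ 1 / suc n) * dilcher (suc n) k)) + ((+ 1 / 4) * dilcherPred n k))
        ⇔ (coeff (threeTermLHS (n ∸ 1)) (suc n ∸ 2 ℕ.* k) ≡ 0i))
    ×
    -- (3)  the three-term recurrence itself, for every m+1 ≥ 1:
    --      (m+2) P_{m+2} - 2x P_{m+1} + (m+2) P_m = 0 (coefficientwise)
    ((m j : ℕ) → coeff (threeTermLHS m) j ≡ 0i)
mainTheorem6 =
    dilcher-meixnerPollaczek
  , (λ n k _ _ → dilcherRecurrence⇔threeTermRecurrence n k)
  , threeTermRecurrence
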